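{- Let $G=(V,E)$ be a simple graph containing a simple cycle $C$, and let $A$ and $B$ be distinct odd-cardinality subsets of $E(C)$. Then no point of $\mathscr{Q}(G)$ violates both the odd cycle inequality $OC(A)$ and the odd cycle inequality $OC(B)$; i.e., the portions of $\mathscr{Q}(G)$ removed by $OC(A)$ and by $OC(B)$ are disjoint.
   Context: $\mathscr{Q}(G)$ is the set of points $(x,y)$, $x_i\in[0,1]$ ($i\in V$), $y_{ij}\in[0,1]$ ($(i,j)\in E$), satisfying for each edge $(i,j)$: $y_{ij}\ge0$, $y_{ij}\le x_i$, $y_{ij}\le x_j$, $x_i+x_j\le1+y_{ij}$. For a simple cycle $C=(V(C),E(C))$ of $G$ and an odd-cardinality $A\subseteq E(C)$, let $S_0=\{i\in V(C): i$ incident to no element of $A\}$, $S_2=\{i\in V(C): i$ incident to two elements of $A\}$. The odd cycle inequality $OC(A)$ is \[ \sum_{i\in S_2}x_i-\sum_{i\in S_0}x_i+\sum_{(i,j)\in E\setminus A}y_{ij}-\sum_{(i,j)\in A}y_{ij}\le\lfloor |A|/2\rfloor, \] and a point violates it if the left side strictly exceeds the right side.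
   Formalization: Only points of $\mathscr{Q}(G)$ with rational coordinates $x_i$ and $y_{ij}$ are considered. -}

module Defs where

open import Data.Nat as ℕ using (ℕ; zero; suc; NonZero)
open import Data.Nat.DivMod using (_%_; _/_; m%n<n)
open import Data.Fin using (Fin; toℕ; fromℕ<; _≟_)
open import Data.Fin.Subset using (Subset; Side; inside; outside; ∣_∣)
open import Data.Vec using (lookup)
open import Data.Integer using (+_)
open import Data.Rational as ℚ using (ℚ; 0ℚ; 1ℚ; _+_; _-_; _≤_; _<_)
open import Data.Product using (_×_)
open import Relation.Binary.PropositionalEquality using (_≡_)
open import Relation.Nullary using (¬_; yes; no)
open import Function using (_∘_; Injective)

record Graph (n : ℕ) : Set₁ where
  field
    Adj    : Fin n → Fin n → Set
    sym    : ∀ {i j} → Adj i j → Adj j i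
    irrefl : ∀ {i} → ¬ Adj i i

sumℚ : ∀ {k} → (Fin k → ℚ) → ℚ
sumℚ {zero}  f = 0ℚ
sumℚ {suc k} f = f Fin.zero + sumℚ (f ∘ Fin.suc)

sumℕ : ∀ {k} → (Fin k → ℕ) → ℕ
sumℕ {zero}  f = 0
sumℕ {suc k} f = f Fin.zero ℕ.+ sumℕ (f ∘ Fin.suc)

cycLen : ℕ → ℕ
cycLen m = suc (suc (suc m))

next : ∀ {m} → Fin (cycLen m) → Fin (cycLen m)
next {m} t = fromℕ< (m%n<n (suc (toℕ t)) (cycLen m))

-- A simple cycle in G: distinct vertices v₀,…,v_{L-1} (L ≥ 3), with
-- edges (v_t, v_{t+1 mod L}); edge t of the cycle has index t : Fin L.
record Cycle {n : ℕ} (G : Graph n) : Set where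
  field
    m      : ℕ
    vtx    : Fin (cycLen m) → Fin n
    inj    : Injective _≡_ _≡_ vtx
    adj    : ∀ t → Graph.Adj G (vtx t) (vtx (next t))

-- The polytope Q(G), for points with rational coordinates.
-- y is indexed by ordered pairs but must be symmetric on edges
-- (i.e. it is a function of the unordered edge {i,j}).
InQ : ∀ {n} → Graph n → (Fin n → ℚ) → (Fin n → Fin n → ℚ) → Set
InQ {n} G x y =
  (∀ i → (0ℚ ≤ x i) × (x i ≤ 1ℚ)) ×
  (∀ i j → Graph.Adj G i j →
     (y i j ≡ y j i) ×
     (0ℚ ≤ y i j) × (y i j ≤ 1ℚ) ×
     (y i j ≤ x i) × (y i j ≤ x j) ×
     (x i + x j ≤ 1ℚ + y i j))

Odd : ℕ → Set
Odd k = k % 2 ≡ 1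

indℕ : ∀ {k} → Subset k → Fin k → ℕ
indℕ A t with lookup A t
... | inside  = 1
... | outside = 0

eqInd : ∀ {k} → Fin k → Fin k → ℕ
eqInd a b with a ≟ b
... | yes _ = 1
... | no  _ = 0

incA : ∀ {m} → Subset (cycLen m) → Fin (cycLen m) → ℕ
incA A s = sumℕ (λ t → indℕ A t ℕ.* (eqInd t s ℕ.+ eqInd (next t) s))

-- coefficient of x_{v_s}: -1 if s ∈ S₀ (no incident A-edge),
-- +1 if s ∈ S₂ (two incident A-edges), 0 otherwise
coefOfCount : ℕ → ℚ
coefOfCount 0 = ℚ.- 1ℚ
coefOfCount 2 = 1ℚ
coefOfCount _ = 0ℚ

xCoef : ∀ {m} → Subset (cycLen m) → Fin (cycLen m) → ℚ
xCoef A s = coefOfCount (incA A s)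

yCoef : ∀ {k} → Subset k → Fin k → ℚ
yCoef A t with lookup A t
... | inside  = ℚ.- 1ℚ
... | outside = 1ℚ

ocLHS : ∀ {n} {G : Graph n} (C : Cycle G) → Subset (cycLen (Cycle.m C)) →
        (Fin n → ℚ) → (Fin n → Fin n → ℚ) → ℚ
ocLHS C A x y =
  sumℚ (λ s → xCoef A s ℚ.* x (vtx s)) +
  sumℚ (λ t → yCoef A t ℚ.* y (vtx t) (vtx (next t)))
  where open Cycle C

ocRHS : ∀ {k} → Subset k → ℚ
ocRHS A = (+ (∣ A ∣ / 2)) ℚ./ 1

Violates : ∀ {n} {G : Graph n} (C : Cycle G) → Subset (cycLen (Cycle.m C)) →
           (Fin n → ℚ) → (Fin n → Fin n → ℚ) → Set
Violates C A x y = ocRHS A < ocLHS C A x y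

{-# OPTIONS --safe #-}
-- On Q(G) every cycle edge t = ij has slack D_t = x_i + x_j - 2 y_ij ∈ [0,1]. Sharing the
-- coefficient of each x_v between the two cycle edges at v gives 2 LHS(S) ≤ Σ_t ±D_t, with +
-- on the edges of S and - on the others. Added up for A and B, an edge in exactly one of the
-- sets contributes 0, an edge in neither at most 0 and an edge in both at most 2, so
-- LHS(A) + LHS(B) ≤ |A ∩ B|. As |A ∩ B| + |A ∪ B| = |A| + |B|, |A ∩ B| < |A ∪ B| (since A ≠ B)
-- and |A|, |B| are odd, |A ∩ B| ≤ ⌊|A|/2⌋ + ⌊|B|/2⌋ = RHS(A) + RHS(B): A and B cannot both be violated.
module Submission where

open import Defs
open import Data.Nat using (ℕ)
open import Data.Fin using (Fin)
open import Data.Fin.Subset using (Subset; ∣_∣)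
open import Data.Rational using (ℚ)
open import Relation.Binary.PropositionalEquality using (_≢_)
open import Relation.Nullary using (¬_)
open import Data.Product using (_×_)

open import Algebra.Bundles using (Ring; CommutativeMonoid)
open import Data.Bool using (_∧_)
open import Data.Fin using (zero; suc; toℕ; _≟_)
open import Data.Fin.Properties using (toℕ-fromℕ<; toℕ-injective; toℕ<n; suc-injective; 0≢1+n)
open import Data.Fin.Subset using (Side; inside; outside; _∩_; _∪_)
open import Data.Fin.Subset.Properties using (∣p∩q∣≤∣p∣; ∣p∣≤∣p∪q∣)
import Data.Integer as ℤ
import Data.Integer.Properties as ℤ
open import Data.Nat as ℕ using (suc; z≤n; s≤s; _%_)
import Data.Nat.Properties as ℕ
open import Data.Nat.Coprimality as Coprime using (1-coprimeTo)
open import Data.Nat.DivMod using (m≡m%n+[m/n]*n; m<n⇒m%n≡m; n%n≡0)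
open import Data.Nat.Tactic.RingSolver using (solve-∀)
open import Data.Product using (_,_; proj₁)
open import Data.Rational using (mkℚ; 0ℚ; 1ℚ; _+_; _-_; _*_; -_; _≤_; _/_; nonNegative)
open import Data.Rational.Properties hiding (_≟_)
open import Data.Rational.Solver using (module +-*-Solver)
open import Data.Sum using (inj₁; inj₂)
open import Data.Vec using ([]; _∷_; lookup)
open import Data.Vec.Properties using (lookup-zipWith)
open import Function using (_∘_; id; Injective)
open import Relation.Binary.PropositionalEquality as ≡
  using (_≡_; refl; cong; cong₂; trans; subst)
open import Relation.Nullary using (Dec; yes; no; contradiction)

open import Algebra.Properties.Semiring.Sum (Ring.semiring +-*-ring)
  using (sum; ∑-distrib-+; ∑-comm; *-distribˡ-sum; *-distribʳ-sum; sum-cong-≗; sum-replicate-zero)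
open import Algebra.Properties.CommutativeSemigroup
  (CommutativeMonoid.commutativeSemigroup +-0-commutativeMonoid) using (interchange)

ι : ℕ → ℚ
ι n = ℤ.+ n / 1

ι≡mkℚ : ∀ n → ι n ≡ mkℚ (ℤ.+ n) 0 (Coprime.sym (1-coprimeTo n))
ι≡mkℚ n = ↥p/↧p≡p (mkℚ (ℤ.+ n) 0 _)

ι-+ : ∀ m n → ι (m ℕ.+ n) ≡ ι m + ι n
ι-+ m n = begin
  ℤ.+ (m ℕ.+ n) / 1                          ≡⟨ /-cong (cong₂ ℤ._+_ (ℤ.*-identityʳ (ℤ.+ m)) (ℤ.*-identityʳ (ℤ.+ n))) refl ⟨
  (ℤ.+ m ℤ.* ℤ.+ 1 ℤ.+ ℤ.+ n ℤ.* ℤ.+ 1) / 1  ≡⟨ cong₂ _+_ (ι≡mkℚ m) (ι≡mkℚ n) ⟨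
  ι m + ι n                                  ∎
  where open ≡.≡-Reasoning

ι-nonNeg : ∀ n → 0ℚ ≤ ι n
ι-nonNeg n = subst (0ℚ ≤_) (≡.sym (ι≡mkℚ n)) (nonNegative⁻¹ _)

ι-mono-≤ : ∀ {m n} → m ℕ.≤ n → ι m ≤ ι n
ι-mono-≤ {m} {n} m≤n = begin
  ι m                 ≡⟨ +-identityʳ (ι m) ⟨
  ι m + 0ℚ            ≤⟨ +-monoʳ-≤ (ι m) (ι-nonNeg (n ℕ.∸ m)) ⟩
  ι m + ι (n ℕ.∸ m)   ≡⟨ ι-+ m (n ℕ.∸ m) ⟨
  ι (m ℕ.+ (n ℕ.∸ m)) ≡⟨ cong ι (ℕ.m+[n∸m]≡n m≤n) ⟩
  ι n                 ∎
  where open ≤-Reasoning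

p≤q⇒0≤q-p : ∀ {p q} → p ≤ q → 0ℚ ≤ q - p
p≤q⇒0≤q-p {p} {q} p≤q = subst (_≤ q - p) (+-inverseʳ p) (+-monoˡ-≤ (- p) p≤q)

sumℚ≡sum : ∀ {k} (f : Fin k → ℚ) → sumℚ f ≡ sum f
sumℚ≡sum {ℕ.zero} f = refl
sumℚ≡sum {suc k}  f = cong (f zero +_) (sumℚ≡sum (f ∘ suc))

ι-sumℕ : ∀ {k} (f : Fin k → ℕ) → ι (sumℕ f) ≡ sum (ι ∘ f)
ι-sumℕ {ℕ.zero} f = refl
ι-sumℕ {suc k}  f = trans (ι-+ (f zero) _) (cong (ι (f zero) +_) (ι-sumℕ (f ∘ suc)))

sum-mono-≤ : ∀ {k} {f g : Fin k → ℚ} → (∀ i → f i ≤ g i) → sum f ≤ sum g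
sum-mono-≤ {ℕ.zero} f≤g = ≤-refl
sum-mono-≤ {suc k}  f≤g = +-mono-≤ (f≤g zero) (sum-mono-≤ (f≤g ∘ suc))

neg-distrib-sum : ∀ {k} (f : Fin k → ℚ) → - sum f ≡ sum (λ i → - f i)
neg-distrib-sum {ℕ.zero} f = refl
neg-distrib-sum {suc k}  f =
  trans (neg-distrib-+ (f zero) _) (cong (- f zero +_) (neg-distrib-sum (f ∘ suc)))

∑-distrib-─ : ∀ {k} (f g : Fin k → ℚ) → sum (λ i → f i - g i) ≡ sum f - sum g
∑-distrib-─ f g = trans (∑-distrib-+ f (λ i → - g i)) (cong (sum f +_) (≡.sym (neg-distrib-sum g)))

eqInd-≡ : ∀ {k} {a b : Fin k} → a ≡ b → eqInd a b ≡ 1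
eqInd-≡ {a = a} {b} a≡b with a ≟ b
... | yes _   = refl
... | no  a≢b = contradiction a≡b a≢b

eqInd-≢ : ∀ {k} {a b : Fin k} → a ≢ b → eqInd a b ≡ 0
eqInd-≢ {a = a} {b} a≢b with a ≟ b
... | yes a≡b = contradiction a≡b a≢b
... | no  _   = refl

eqInd-suc : ∀ {k} (a b : Fin k) → eqInd (suc a) (suc b) ≡ eqInd a b
eqInd-suc a b = by-cases (a ≟ b)
  where
  by-cases : Dec (a ≡ b) → eqInd (suc a) (suc b) ≡ eqInd a b
  by-cases (yes a≡b) = trans (eqInd-≡ (cong suc a≡b)) (≡.sym (eqInd-≡ a≡b))
  by-cases (no  a≢b) = trans (eqInd-≢ (a≢b ∘ suc-injective)) (≡.sym (eqInd-≢ a≢b))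

sum-eqInd-* : ∀ {k} (a : Fin k) (X : Fin k → ℚ) → sum (λ s → ι (eqInd a s) * X s) ≡ X a
sum-eqInd-* {suc k} zero X = begin
  1ℚ * X zero + sum (λ s → 0ℚ * X (suc s)) ≡⟨ cong₂ _+_ (*-identityˡ (X zero)) (sum-cong-≗ (*-zeroˡ ∘ X ∘ suc)) ⟩
  X zero + sum {k} (λ _ → 0ℚ)             ≡⟨ cong (X zero +_) (sum-replicate-zero k) ⟩
  X zero + 0ℚ                              ≡⟨ +-identityʳ (X zero) ⟩
  X zero                                   ∎
  where open ≡.≡-Reasoning
sum-eqInd-* {suc k} (suc a) X = begin
  0ℚ * X zero + sum (λ s → ι (eqInd (suc a) (suc s)) * X (suc s))
    ≡⟨ cong₂ _+_ (*-zeroˡ (X zero)) (sum-cong-≗ (λ s → cong (λ e → ι e * X (suc s)) (eqInd-suc a s))) ⟩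
  0ℚ + sum (λ s → ι (eqInd a s) * X (suc s))
    ≡⟨ +-identityˡ _ ⟩
  sum (λ s → ι (eqInd a s) * X (suc s))
    ≡⟨ sum-eqInd-* a (X ∘ suc) ⟩
  X (suc a) ∎
  where open ≡.≡-Reasoning

injective⇒sum-eqInd≤1 : ∀ {j k} {g : Fin j → Fin k} → Injective _≡_ _≡_ g →
                      ∀ s → sum (λ t → ι (eqInd (g t) s)) ≤ 1ℚ
injective⇒sum-eqInd≤1 {ℕ.zero} _ s = nonNegative⁻¹ 1ℚ
injective⇒sum-eqInd≤1 {suc j} {g = g} g-inj s with g zero ≟ s
... | yes g0≡s = ≤-reflexive (begin
  1ℚ + sum (λ t → ι (eqInd (g (suc t)) s)) ≡⟨ cong (1ℚ +_) (sum-cong-≗ (cong ι ∘ eqInd-≢ ∘ g[1+t]≢s)) ⟩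
  1ℚ + sum {j} (λ _ → 0ℚ)                 ≡⟨ cong (1ℚ +_) (sum-replicate-zero j) ⟩
  1ℚ                                      ∎)
  where
  open ≡.≡-Reasoning
  g[1+t]≢s : ∀ t → g (suc t) ≢ s
  g[1+t]≢s t g[1+t]≡s = 0≢1+n (g-inj (trans g0≡s (≡.sym g[1+t]≡s)))
... | no _ = subst (_≤ 1ℚ) (≡.sym (+-identityˡ _))
  (injective⇒sum-eqInd≤1 (suc-injective ∘ g-inj) s)

suc-%-injective : ∀ {a b n} → a ℕ.< suc n → b ℕ.< suc n → suc a % suc n ≡ suc b % suc n → a ≡ b
suc-%-injective {a} {b} {n} a<n b<n eq with ℕ.m≤n⇒m<n∨m≡n a<n | ℕ.m≤n⇒m<n∨m≡n b<n
... | inj₁ 1+a<n | inj₁ 1+b<n = ℕ.suc-injective (begin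
  suc a         ≡⟨ m<n⇒m%n≡m 1+a<n ⟨
  suc a % suc n ≡⟨ eq ⟩
  suc b % suc n ≡⟨ m<n⇒m%n≡m 1+b<n ⟩
  suc b         ∎)
  where open ≡.≡-Reasoning
... | inj₁ 1+a<n | inj₂ refl =
  contradiction (trans (≡.sym (m<n⇒m%n≡m 1+a<n)) (trans eq (n%n≡0 (suc b)))) ℕ.1+n≢0
... | inj₂ refl | inj₁ 1+b<n =
  contradiction (trans (≡.sym (m<n⇒m%n≡m 1+b<n)) (trans (≡.sym eq) (n%n≡0 (suc a)))) ℕ.1+n≢0
... | inj₂ 1+a≡n | inj₂ 1+b≡n = ℕ.suc-injective (trans 1+a≡n (≡.sym 1+b≡n))

next-injective : ∀ {m} → Injective _≡_ _≡_ (next {m})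
next-injective {m} {s} {t} eq = toℕ-injective (suc-%-injective (toℕ<n s) (toℕ<n t) (begin
  suc (toℕ s) % cycLen m ≡⟨ toℕ-fromℕ< _ ⟨
  toℕ (next s)           ≡⟨ cong toℕ eq ⟩
  toℕ (next t)           ≡⟨ toℕ-fromℕ< _ ⟩
  suc (toℕ t) % cycLen m ∎))
  where open ≡.≡-Reasoning

module _ {m : ℕ} where

  incident : Fin (cycLen m) → Fin (cycLen m) → ℕ
  incident t s = eqInd t s ℕ.+ eqInd (next t) s

  sum-incident-* : ∀ (X : Fin (cycLen m) → ℚ) t → sum (λ s → ι (incident t s) * X s) ≡ X t + X (next t)
  sum-incident-* X t = begin
    sum (λ s → ι (incident t s) * X s)
      ≡⟨ sum-cong-≗ (λ s → trans (cong (_* X s) (ι-+ (eqInd t s) (eqInd (next t) s)))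
                                  (*-distribʳ-+ (X s) (ι (eqInd t s)) (ι (eqInd (next t) s)))) ⟩
    sum (λ s → ι (eqInd t s) * X s + ι (eqInd (next t) s) * X s)
      ≡⟨ ∑-distrib-+ (λ s → ι (eqInd t s) * X s) (λ s → ι (eqInd (next t) s) * X s) ⟩
    sum (λ s → ι (eqInd t s) * X s) + sum (λ s → ι (eqInd (next t) s) * X s)
      ≡⟨ cong₂ _+_ (sum-eqInd-* t X) (sum-eqInd-* (next t) X) ⟩
    X t + X (next t) ∎
    where open ≡.≡-Reasoning

  -- Equality holds, but the upper bound is all that is needed and only uses that next is injective.
  sum-incident≤2 : ∀ s → sum (λ t → ι (incident t s)) ≤ 1ℚ + 1ℚ
  sum-incident≤2 s = begin
    sum (λ t → ι (incident t s))
      ≡⟨ sum-cong-≗ (λ t → ι-+ (eqInd t s) (eqInd (next t) s)) ⟩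
    sum (λ t → ι (eqInd t s) + ι (eqInd (next t) s))
      ≡⟨ ∑-distrib-+ (λ t → ι (eqInd t s)) (λ t → ι (eqInd (next t) s)) ⟩
    sum (λ t → ι (eqInd t s)) + sum (λ t → ι (eqInd (next t) s))
      ≤⟨ +-mono-≤ (injective⇒sum-eqInd≤1 id s) (injective⇒sum-eqInd≤1 next-injective s) ⟩
    1ℚ + 1ℚ ∎
    where open ≤-Reasoning

  edge-sum≡vertex-sum : ∀ (w X : Fin (cycLen m) → ℚ) →
    sum (λ t → w t * (X t + X (next t))) ≡ sum (λ s → sum (λ t → w t * ι (incident t s)) * X s)
  edge-sum≡vertex-sum w X = begin
    sum (λ t → w t * (X t + X (next t)))
      ≡⟨ sum-cong-≗ (λ t → cong (w t *_) (≡.sym (sum-incident-* X t))) ⟩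
    sum (λ t → w t * sum (λ s → ι (incident t s) * X s))
      ≡⟨ sum-cong-≗ (λ t → *-distribˡ-sum (w t) (λ s → ι (incident t s) * X s)) ⟩
    sum (λ t → sum (λ s → w t * (ι (incident t s) * X s)))
      ≡⟨ ∑-comm (λ t s → w t * (ι (incident t s) * X s)) ⟩
    sum (λ s → sum (λ t → w t * (ι (incident t s) * X s)))
      ≡⟨ sum-cong-≗ (λ s → sum-cong-≗ (λ t → ≡.sym (*-assoc (w t) (ι (incident t s)) (X s)))) ⟩
    sum (λ s → sum (λ t → w t * ι (incident t s) * X s))
      ≡⟨ sum-cong-≗ (λ s → *-distribʳ-sum (X s) (λ t → w t * ι (incident t s))) ⟨
    sum (λ s → sum (λ t → w t * ι (incident t s)) * X s) ∎
    where open ≡.≡-Reasoning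

sign : Side → ℚ
sign inside  = 1ℚ
sign outside = - 1ℚ

ind : Side → ℕ
ind inside  = 1
ind outside = 0

indℕ≡ind : ∀ {k} (S : Subset k) t → indℕ S t ≡ ind (lookup S t)
indℕ≡ind S t with lookup S t
... | inside  = refl
... | outside = refl

yCoef≡-sign : ∀ {k} (S : Subset k) t → yCoef S t ≡ - sign (lookup S t)
yCoef≡-sign S t with lookup S t
... | inside  = refl
... | outside = refl

sign-*-ι : ∀ a n → sign a * ι n ≡ (ι (ind a ℕ.* n) + ι (ind a ℕ.* n)) - ι n
sign-*-ι inside n rewrite ℕ.+-identityʳ n =
  solve 1 (λ x → con 1ℚ :* x := (x :+ x) :- x) refl (ι n)
  where open +-*-Solver
sign-*-ι outside n =
  solve 1 (λ x → con (- 1ℚ) :* x := (con 0ℚ :+ con 0ℚ) :- x) refl (ι n)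
  where open +-*-Solver

coefOfCount≤ι-1 : ∀ k → coefOfCount k ≤ ι k - 1ℚ
coefOfCount≤ι-1 0 = ≤-refl
coefOfCount≤ι-1 1 = ≤-refl
coefOfCount≤ι-1 2 = ≤-refl
coefOfCount≤ι-1 (suc (suc (suc k))) = p≤q⇒0≤q-p (ι-mono-≤ {1} {3 ℕ.+ k} (s≤s z≤n))

module _ {m : ℕ} (S : Subset (cycLen m)) where

  sum-sign-incident : ∀ s → sum (λ t → sign (lookup S t) * ι (incident t s))
                          ≡ (ι (incA S s) + ι (incA S s)) - sum (λ t → ι (incident t s))
  sum-sign-incident s = begin
    sum (λ t → sign (lookup S t) * ι (incident t s))
      ≡⟨ sum-cong-≗ sign-term ⟩
    sum (λ t → (a t + a t) - ι (incident t s))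
      ≡⟨ ∑-distrib-─ (λ t → a t + a t) (λ t → ι (incident t s)) ⟩
    sum (λ t → a t + a t) - sum (λ t → ι (incident t s))
      ≡⟨ cong (_- _) (∑-distrib-+ a a) ⟩
    (sum a + sum a) - sum (λ t → ι (incident t s))
      ≡⟨ cong (λ i → (i + i) - sum (λ t → ι (incident t s))) (ι-sumℕ (λ t → indℕ S t ℕ.* incident t s)) ⟨
    (ι (incA S s) + ι (incA S s)) - sum (λ t → ι (incident t s)) ∎
    where
    open ≡.≡-Reasoning
    a : Fin (cycLen m) → ℚ
    a t = ι (indℕ S t ℕ.* incident t s)
    sign-term : ∀ t → sign (lookup S t) * ι (incident t s) ≡ (a t + a t) - ι (incident t s)
    sign-term t = trans (sign-*-ι (lookup S t) (incident t s))
      (cong (λ j → (ι (j ℕ.* incident t s) + ι (j ℕ.* incident t s)) - ι (incident t s)) (≡.sym (indℕ≡ind S t)))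

  xCoef-double≤ : ∀ s → xCoef S s + xCoef S s ≤ sum (λ t → sign (lookup S t) * ι (incident t s))
  xCoef-double≤ s = begin
    xCoef S s + xCoef S s             ≤⟨ +-mono-≤ (coefOfCount≤ι-1 k) (coefOfCount≤ι-1 k) ⟩
    (ι k - 1ℚ) + (ι k - 1ℚ)           ≡⟨ regroup (ι k) ⟩
    (ι k + ι k) - (1ℚ + 1ℚ)           ≤⟨ +-monoʳ-≤ (ι k + ι k) (neg-antimono-≤ (sum-incident≤2 s)) ⟩
    (ι k + ι k) - sum (λ t → ι (incident t s)) ≡⟨ sum-sign-incident s ⟨
    sum (λ t → sign (lookup S t) * ι (incident t s)) ∎
    where
    open ≤-Reasoning
    k = incA S s
    regroup : ∀ x → (x - 1ℚ) + (x - 1ℚ) ≡ (x + x) - (1ℚ + 1ℚ)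
    regroup = solve 1 (λ x → (x :- con 1ℚ) :+ (x :- con 1ℚ) := (x :+ x) :- (con 1ℚ :+ con 1ℚ)) refl
      where open +-*-Solver

  xCoef-sum-double≤ : (X : Fin (cycLen m) → ℚ) → (∀ s → 0ℚ ≤ X s) →
    sum (λ s → xCoef S s * X s) + sum (λ s → xCoef S s * X s) ≤ sum (λ t → sign (lookup S t) * (X t + X (next t)))
  xCoef-sum-double≤ X X≥0 = begin
    sum (λ s → xCoef S s * X s) + sum (λ s → xCoef S s * X s)
      ≡⟨ ∑-distrib-+ (λ s → xCoef S s * X s) (λ s → xCoef S s * X s) ⟨
    sum (λ s → xCoef S s * X s + xCoef S s * X s)
      ≡⟨ sum-cong-≗ (λ s → *-distribʳ-+ (X s) (xCoef S s) (xCoef S s)) ⟨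
    sum (λ s → (xCoef S s + xCoef S s) * X s)
      ≤⟨ sum-mono-≤ (λ s → *-monoʳ-≤-nonNeg (X s) {{nonNegative (X≥0 s)}} (xCoef-double≤ s)) ⟩
    sum (λ s → sum (λ t → sign (lookup S t) * ι (incident t s)) * X s)
      ≡⟨ edge-sum≡vertex-sum (sign ∘ lookup S) X ⟨
    sum (λ t → sign (lookup S t) * (X t + X (next t))) ∎
    where open ≤-Reasoning

slack : ∀ {n} → (Fin n → ℚ) → (Fin n → Fin n → ℚ) → Fin n → Fin n → ℚ
slack x y i j = (x i + x j) - (y i j + y i j)

slack∈[0,1] : ∀ {n} {G : Graph n} {x y} → InQ G x y → ∀ {i j} → Graph.Adj G i j →
               0ℚ ≤ slack x y i j × slack x y i j ≤ 1ℚ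
slack∈[0,1] {x = x} {y} (_ , edge) {i} {j} ij
  with edge i j ij
... | _ , 0≤y , _ , y≤xi , y≤xj , xi+xj≤1+y = p≤q⇒0≤q-p (+-mono-≤ y≤xi y≤xj) , (begin
  (x i + x j) - (y i j + y i j)  ≤⟨ +-monoˡ-≤ (- (y i j + y i j)) xi+xj≤1+y ⟩
  (1ℚ + y i j) - (y i j + y i j) ≡⟨ cancel (y i j) ⟩
  1ℚ - y i j                     ≤⟨ +-monoʳ-≤ 1ℚ (neg-antimono-≤ 0≤y) ⟩
  1ℚ                             ∎)
  where
  open ≤-Reasoning
  cancel : ∀ z → (1ℚ + z) - (z + z) ≡ 1ℚ - z
  cancel = solve 1 (λ z → (con 1ℚ :+ z) :- (z :+ z) := con 1ℚ :- z) refl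
    where open +-*-Solver

ocLHS-double≤ : ∀ {n} {G : Graph n} (C : Cycle G) S x y → (∀ i → 0ℚ ≤ x i) →
  ocLHS C S x y + ocLHS C S x y
    ≤ sum (λ t → sign (lookup S t) * slack x y (Cycle.vtx C t) (Cycle.vtx C (next t)))
ocLHS-double≤ C S x y x≥0 = begin
  (V + E) + (V + E)             ≡⟨ interchange V E V E ⟩
  (V + V) + (E + E)             ≡⟨ cong₂ (λ v e → (v + v) + (e + e)) (sumℚ≡sum vterm) (sumℚ≡sum eterm) ⟩
  (ΣV + ΣV) + (ΣE + ΣE)         ≤⟨ +-monoˡ-≤ (ΣE + ΣE) (xCoef-sum-double≤ S X (x≥0 ∘ vtx)) ⟩
  sum (λ t → sign (lookup S t) * P t) + (ΣE + ΣE)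
    ≡⟨ cong (sum (λ t → sign (lookup S t) * P t) +_) (∑-distrib-+ eterm eterm) ⟨
  sum (λ t → sign (lookup S t) * P t) + sum (λ t → eterm t + eterm t)
    ≡⟨ ∑-distrib-+ (λ t → sign (lookup S t) * P t) (λ t → eterm t + eterm t) ⟨
  sum (λ t → sign (lookup S t) * P t + (eterm t + eterm t))
    ≡⟨ sum-cong-≗ (λ t → trans (cong (λ c → sign (lookup S t) * P t + (c * Y t + c * Y t)) (yCoef≡-sign S t))
                               (combine (sign (lookup S t)) (P t) (Y t))) ⟩
  sum (λ t → sign (lookup S t) * (P t - (Y t + Y t))) ∎
  where
  open ≤-Reasoning
  open Cycle C
  X : Fin (cycLen m) → ℚ
  X s = x (vtx s)
  Y P : Fin (cycLen m) → ℚ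
  Y t = y (vtx t) (vtx (next t))
  P t = X t + X (next t)
  vterm eterm : Fin (cycLen m) → ℚ
  vterm s = xCoef S s * X s
  eterm t = yCoef S t * Y t
  V = sumℚ vterm
  E = sumℚ eterm
  ΣV = sum vterm
  ΣE = sum eterm
  combine : ∀ σ p z → σ * p + (- σ * z + - σ * z) ≡ σ * (p - (z + z))
  combine = solve 3 (λ σ p z → σ :* p :+ (:- σ :* z :+ :- σ :* z) := σ :* (p :- (z :+ z))) refl
    where open +-*-Solver

sign-pair≤ : ∀ a b {D} → 0ℚ ≤ D → D ≤ 1ℚ → sign a * D + sign b * D ≤ ι (ind (a ∧ b)) + ι (ind (a ∧ b))
sign-pair≤ inside  inside  {D} _   D≤1 = +-mono-≤ 1*D≤1 1*D≤1
  where 1*D≤1 = subst (_≤ 1ℚ) (≡.sym (*-identityˡ D)) D≤1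
sign-pair≤ inside  outside {D} _   _   = ≤-reflexive (solve 1 (λ d → con 1ℚ :* d :+ con (- 1ℚ) :* d := con 0ℚ) refl D)
  where open +-*-Solver
sign-pair≤ outside inside  {D} _   _   = ≤-reflexive (solve 1 (λ d → con (- 1ℚ) :* d :+ con 1ℚ :* d := con 0ℚ) refl D)
  where open +-*-Solver
sign-pair≤ outside outside {D} 0≤D _   = +-mono-≤ -1*D≤0 -1*D≤0
  where
  open +-*-Solver
  -1*D≤0 = subst (_≤ 0ℚ) (solve 1 (λ d → :- d := con (- 1ℚ) :* d) refl D) (neg-antimono-≤ 0≤D)

sum-ind≡∣p∣ : ∀ {k} (p : Subset k) → sum (λ t → ι (ind (lookup p t))) ≡ ι ∣ p ∣
sum-ind≡∣p∣ []            = refl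
sum-ind≡∣p∣ (inside ∷ p)  = trans (cong (1ℚ +_) (sum-ind≡∣p∣ p)) (≡.sym (ι-+ 1 ∣ p ∣))
sum-ind≡∣p∣ (outside ∷ p) = trans (+-identityˡ _) (sum-ind≡∣p∣ p)

sum-sign-pair≤ : ∀ {k} (A B : Subset k) (D : Fin k → ℚ) → (∀ t → 0ℚ ≤ D t × D t ≤ 1ℚ) →
  sum (λ t → sign (lookup A t) * D t) + sum (λ t → sign (lookup B t) * D t) ≤ ι ∣ A ∩ B ∣ + ι ∣ A ∩ B ∣
sum-sign-pair≤ A B D D∈[0,1] = begin
  sum (λ t → sign (lookup A t) * D t) + sum (λ t → sign (lookup B t) * D t)
    ≡⟨ ∑-distrib-+ (λ t → sign (lookup A t) * D t) (λ t → sign (lookup B t) * D t) ⟨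
  sum (λ t → sign (lookup A t) * D t + sign (lookup B t) * D t)
    ≤⟨ sum-mono-≤ pointwise ⟩
  sum (λ t → i t + i t)
    ≡⟨ ∑-distrib-+ i i ⟩
  sum i + sum i
    ≡⟨ cong₂ _+_ (sum-ind≡∣p∣ (A ∩ B)) (sum-ind≡∣p∣ (A ∩ B)) ⟩
  ι ∣ A ∩ B ∣ + ι ∣ A ∩ B ∣ ∎
  where
  open ≤-Reasoning
  i : Fin _ → ℚ
  i t = ι (ind (lookup (A ∩ B) t))
  pointwise : ∀ t → sign (lookup A t) * D t + sign (lookup B t) * D t ≤ i t + i t
  pointwise t with D∈[0,1] t
  ... | 0≤D , D≤1 rewrite lookup-zipWith _∧_ t A B = sign-pair≤ (lookup A t) (lookup B t) 0≤D D≤1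

∣p∩q∣+∣p∪q∣≡∣p∣+∣q∣ : ∀ {k} (p q : Subset k) → ∣ p ∩ q ∣ ℕ.+ ∣ p ∪ q ∣ ≡ ∣ p ∣ ℕ.+ ∣ q ∣
∣p∩q∣+∣p∪q∣≡∣p∣+∣q∣ []            []            = refl
∣p∩q∣+∣p∪q∣≡∣p∣+∣q∣ (inside  ∷ p) (inside  ∷ q) = cong suc (begin
  ∣ p ∩ q ∣ ℕ.+ suc ∣ p ∪ q ∣   ≡⟨ ℕ.+-suc _ _ ⟩
  suc (∣ p ∩ q ∣ ℕ.+ ∣ p ∪ q ∣) ≡⟨ cong suc (∣p∩q∣+∣p∪q∣≡∣p∣+∣q∣ p q) ⟩
  suc (∣ p ∣ ℕ.+ ∣ q ∣)         ≡⟨ ℕ.+-suc _ _ ⟨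
  ∣ p ∣ ℕ.+ suc ∣ q ∣           ∎)
  where open ≡.≡-Reasoning
∣p∩q∣+∣p∪q∣≡∣p∣+∣q∣ (inside  ∷ p) (outside ∷ q) =
  trans (ℕ.+-suc _ _) (cong suc (∣p∩q∣+∣p∪q∣≡∣p∣+∣q∣ p q))
∣p∩q∣+∣p∪q∣≡∣p∣+∣q∣ (outside ∷ p) (inside  ∷ q) =
  trans (ℕ.+-suc _ _) (trans (cong suc (∣p∩q∣+∣p∪q∣≡∣p∣+∣q∣ p q)) (≡.sym (ℕ.+-suc _ _)))
∣p∩q∣+∣p∪q∣≡∣p∣+∣q∣ (outside ∷ p) (outside ∷ q) = ∣p∩q∣+∣p∪q∣≡∣p∣+∣q∣ p q

p≢q⇒∣p∩q∣<∣p∪q∣ : ∀ {k} (p q : Subset k) → p ≢ q → ∣ p ∩ q ∣ ℕ.< ∣ p ∪ q ∣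
p≢q⇒∣p∩q∣<∣p∪q∣ []            []            p≢q = contradiction refl p≢q
p≢q⇒∣p∩q∣<∣p∪q∣ (inside  ∷ p) (inside  ∷ q) p≢q = s≤s (p≢q⇒∣p∩q∣<∣p∪q∣ p q (p≢q ∘ cong (inside ∷_)))
p≢q⇒∣p∩q∣<∣p∪q∣ (outside ∷ p) (outside ∷ q) p≢q = p≢q⇒∣p∩q∣<∣p∪q∣ p q (p≢q ∘ cong (outside ∷_))
p≢q⇒∣p∩q∣<∣p∪q∣ (inside  ∷ p) (outside ∷ q) _   = s≤s (ℕ.≤-trans (∣p∩q∣≤∣p∣ p q) (∣p∣≤∣p∪q∣ p q))
p≢q⇒∣p∩q∣<∣p∪q∣ (outside ∷ p) (inside  ∷ q) _   = s≤s (ℕ.≤-trans (∣p∩q∣≤∣p∣ p q) (∣p∣≤∣p∪q∣ p q))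

odd⇒≡1+2[k/2] : ∀ k → Odd k → k ≡ 1 ℕ.+ k ℕ./ 2 ℕ.* 2
odd⇒≡1+2[k/2] k odd = trans (m≡m%n+[m/n]*n k 2) (cong (ℕ._+ k ℕ./ 2 ℕ.* 2) odd)

∣p∩q∣≤∣p∣/2+∣q∣/2 : ∀ {k} (p q : Subset k) → Odd ∣ p ∣ → Odd ∣ q ∣ → p ≢ q →
                    ∣ p ∩ q ∣ ℕ.≤ ∣ p ∣ ℕ./ 2 ℕ.+ ∣ q ∣ ℕ./ 2
∣p∩q∣≤∣p∣/2+∣q∣/2 p q odd-p odd-q p≢q = ℕ.≤-pred (halve 2i<2[a+b+1])
  where
  open ℕ.≤-Reasoning
  i = ∣ p ∩ q ∣
  a = ∣ p ∣ ℕ./ 2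
  b = ∣ q ∣ ℕ./ 2
  halve : ∀ {m n} → m ℕ.+ m ℕ.< n ℕ.+ n → m ℕ.< n
  halve m+m<n+n = ℕ.≰⇒> (λ n≤m → ℕ.<⇒≱ m+m<n+n (ℕ.+-mono-≤ n≤m n≤m))
  regroup : ∀ a b → (1 ℕ.+ a ℕ.* 2) ℕ.+ (1 ℕ.+ b ℕ.* 2) ≡ suc (a ℕ.+ b) ℕ.+ suc (a ℕ.+ b)
  regroup = solve-∀
  2i<2[a+b+1] : i ℕ.+ i ℕ.< suc (a ℕ.+ b) ℕ.+ suc (a ℕ.+ b)
  2i<2[a+b+1] = begin-strict
    i ℕ.+ i                                 <⟨ ℕ.+-monoʳ-< i (p≢q⇒∣p∩q∣<∣p∪q∣ p q p≢q) ⟩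
    i ℕ.+ ∣ p ∪ q ∣                         ≡⟨ ∣p∩q∣+∣p∪q∣≡∣p∣+∣q∣ p q ⟩
    ∣ p ∣ ℕ.+ ∣ q ∣                         ≡⟨ cong₂ ℕ._+_ (odd⇒≡1+2[k/2] ∣ p ∣ odd-p) (odd⇒≡1+2[k/2] ∣ q ∣ odd-q) ⟩
    (1 ℕ.+ a ℕ.* 2) ℕ.+ (1 ℕ.+ b ℕ.* 2)     ≡⟨ regroup a b ⟩
    suc (a ℕ.+ b) ℕ.+ suc (a ℕ.+ b)         ∎

lemma16 : ∀ {n} (G : Graph n) (C : Cycle G) (A B : Subset (cycLen (Cycle.m C))) →
    Odd ∣ A ∣ → Odd ∣ B ∣ → A ≢ B →
    (x : Fin n → ℚ) (y : Fin n → Fin n → ℚ) → InQ G x y →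
    ¬ (Violates C A x y × Violates C B x y)
lemma16 G C A B odd-A odd-B A≢B x y x∈Q (A-violated , B-violated) = <-irrefl refl (begin-strict
  (a + b) + (a + b)        <⟨ +-mono-< (+-mono-< A-violated B-violated) (+-mono-< A-violated B-violated) ⟩
  (LA + LB) + (LA + LB)    ≡⟨ interchange LA LB LA LB ⟩
  (LA + LA) + (LB + LB)    ≤⟨ +-mono-≤ (ocLHS-double≤ C A x y x≥0) (ocLHS-double≤ C B x y x≥0) ⟩
  signed A + signed B      ≤⟨ sum-sign-pair≤ A B D (λ t → slack∈[0,1] {G = G} x∈Q (adj t)) ⟩
  ι i + ι i                ≤⟨ +-mono-≤ i≤a+b i≤a+b ⟩
  (a + b) + (a + b)        ∎)
  where
  open ≤-Reasoning
  open Cycle C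
  a = ocRHS A
  b = ocRHS B
  LA = ocLHS C A x y
  LB = ocLHS C B x y
  i = ∣ A ∩ B ∣
  x≥0 : ∀ v → 0ℚ ≤ x v
  x≥0 v = proj₁ (proj₁ x∈Q v)
  D : Fin (cycLen m) → ℚ
  D t = slack x y (vtx t) (vtx (next t))
  signed : Subset (cycLen m) → ℚ
  signed S = sum (λ t → sign (lookup S t) * D t)
  i≤a+b : ι i ≤ a + b
  i≤a+b = subst (ι i ≤_) (ι-+ (∣ A ∣ ℕ./ 2) (∣ B ∣ ℕ./ 2)) (ι-mono-≤ (∣p∩q∣≤∣p∣/2+∣q∣/2 A B odd-A odd-B A≢B))
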